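{- No graph with more than one connected component is a long-refinement graph.
   Context: All graphs are finite, simple, undirected, with monochromatic initial colouring. Colour Refinement computes $\chi^0_G$ constant and $\chi^i_G(v) = \big(\chi^{i-1}_G(v), \{\!\{\chi^{i-1}_G(w) \mid w \in N(v)\}\!\}\big)$; $\pi^i_G$ is the partition of $V(G)$ into colour classes of $\chi^i_G$, and $\mathrm{WL}_1(G)$ is the least $j \geq 0$ with $\pi^j_G = \pi^{j+1}_G$. A long-refinement graph is a graph $G$ with $\mathrm{WL}_1(G) = |G|-1$. -}

module Defs where

open import Data.Nat using (ℕ; zero; suc; _<_)
open import Data.Fin using (Fin)
open import Data.Bool using (Bool; true; false)
open import Data.List using (List; []; _∷_; _++_; map; filterᵇ; allFin)
open import Data.Product using (_×_; ∃-syntax)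
open import Relation.Binary.PropositionalEquality using (_≡_)
open import Relation.Nullary using (¬_)

record Graph : Set where
  field
    n     : ℕ
    adj   : Fin n → Fin n → Bool
    sym   : ∀ u v → adj u v ≡ adj v u
    irrfl : ∀ v → adj v v ≡ false

open Graph public

∣_∣ᵥ : Graph → ℕ
∣ G ∣ᵥ = n G

N : (G : Graph) → Fin (n G) → List (Fin (n G))
N G v = filterᵇ (adj G v) (allFin (n G))

-- Colours produced by colour refinement: the initial constant colour, or a
-- pair (previous colour, multiset of neighbour colours) where the multiset
-- is represented by a list, compared up to reordering.
data Colour : Set where
  c₀   : Colour
  pair : Colour → List Colour → Colour

mutual
  data _≈_ : Colour → Colour → Set where
    c₀≈   : c₀ ≈ c₀
    pair≈ : ∀ {a b as bs} → a ≈ b → as ≋ bs → pair a as ≈ pair b bs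

  -- multiset equality: bs is a rearrangement of as, elementwise up to ≈
  data _≋_ : List Colour → List Colour → Set where
    []≋ : [] ≋ []
    ∷≋  : ∀ {x y xs ys zs} → x ≈ y → xs ≋ (ys ++ zs) → (x ∷ xs) ≋ (ys ++ y ∷ zs)

χ : (G : Graph) → ℕ → Fin (n G) → Colour
χ G zero    v = c₀
χ G (suc i) v = pair (χ G i v) (map (χ G i) (N G v))

SamePartition : (G : Graph) → ℕ → ℕ → Set
SamePartition G i j =
  ∀ v w → (χ G i v ≈ χ G i w → χ G j v ≈ χ G j w)
        × (χ G j v ≈ χ G j w → χ G i v ≈ χ G i w)

IsWL₁ : Graph → ℕ → Set
IsWL₁ G j = SamePartition G j (suc j) × (∀ k → k < j → ¬ SamePartition G k (suc k))

-- long-refinement graph: WL₁(G) = |G| - 1 (read in ℤ: i.e. WL₁(G) + 1 = |G|)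
LongRefinement : Graph → Set
LongRefinement G = ∃[ j ] (IsWL₁ G j × suc j ≡ ∣ G ∣ᵥ)

data Reachable (G : Graph) : Fin (n G) → Fin (n G) → Set where
  here : ∀ {v} → Reachable G v v
  step : ∀ {u v w} → adj G u v ≡ true → Reachable G v w → Reachable G u w

MoreThanOneComponent : Graph → Set
MoreThanOneComponent G = ∃[ u ] ∃[ v ] ¬ Reachable G u v

module Submission where

-- Let WL₁(G) = j and |G| = j + 1, and count the colour classes produced by
-- Colour Refinement.  Round 0 has one class, every round before j splits a
-- class, and there are never more than |G| = j + 1 classes; so round k has
-- exactly k + 1 classes for k ≤ j, and round j is discrete.  Suppose G
-- splits into two unions of components S and L with 1 ≤ |S| ≤ |L|.  On
-- such a closed set refinement either has separated all its vertices or
-- gains a class in every round, so in round m = |L| - 1 both S and L are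
-- separated.  As m < j, round m + 1 splits a class of round m, which must
-- therefore contain some x ∈ S and ℓ ∈ L.  Round m + 1 has only m + 2
-- classes, so every vertex of S other than x shares its new colour with a
-- vertex of L; this matches the neighbours of x colour-preservingly with
-- those of ℓ, whence round m + 1 does not separate x from ℓ after all.

open import Defs
open import Level using (0ℓ)
open import Data.Bool using (Bool; true; false; T; not; _∨_; _∧_)
open import Data.Bool.Properties using (T?; T-≡; T-∨; T-∧)
open import Data.Bool.ListAction using (any)
open import Data.Unit using (tt)
open import Data.Nat using (ℕ; zero; suc; _+_; _∸_; _≤_; _<_; z≤n; s≤s; s≤s⁻¹)
open import Data.Nat.Properties
  using (module ≤-Reasoning; suc-injective; <-cmp; ≤-trans; ≤-refl; ≤-reflexive; <-irrefl; <⇒≤; ≤-antisym;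
         +-comm; +-suc; +-cancelˡ-≤; +-monoˡ-≤; +-monoʳ-≤; m≤n+m; m∸n+n≡m; m+[n∸m]≡n; _≤?_; ≰⇒>)
  renaming (_<?_ to _<ℕ?_)
open import Data.Nat.Induction using (<-wellFounded)
open import Induction.WellFounded using (Acc; acc)
open import Data.Fin using (Fin; toℕ; _≟_)
import Data.Fin as Fin
open import Data.Fin.Properties using (any?; all?; ¬∀⟶∃¬; toℕ-injective)
open import Data.List using (List; []; _∷_; _++_; map; length; filter; filterᵇ; allFin)
open import Data.List.Properties
  using (++-assoc; map-++; length-++-sucʳ; ∷-injective; length-map; length-filter; length-tabulate)
open import Data.List.Membership.Propositional using (_∈_; find; lose)
open import Data.List.Membership.Propositional.Properties
  using (∈-map⁺; ∈-map⁻; ∈-++⁺ˡ; ∈-++⁺ʳ; ∈-++⁻; ∈-∃++; ∈-filter⁺; ∈-filter⁻; ∈-allFin)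
open import Data.List.Relation.Unary.Any using (Any; here; there)
import Data.List.Relation.Unary.Any as Any
open import Data.List.Relation.Unary.Any.Properties using (any⁺; any⁻)
open import Data.List.Relation.Unary.All using (All; []; _∷_)
import Data.List.Relation.Unary.All as All
import Data.List.Relation.Unary.All.Properties as All
open import Data.List.Relation.Unary.AllPairs using (AllPairs; []; _∷_)
import Data.List.Relation.Unary.AllPairs as AllPairs
open import Data.List.Relation.Unary.Unique.Propositional using (Unique)
open import Data.List.Relation.Unary.Unique.Propositional.Properties using (filter⁺; allFin⁺)
open import Data.Product using (_×_; _,_; proj₁; proj₂; ∃; ∃-syntax; map₁; uncurry)
open import Data.Sum using (_⊎_; inj₁; inj₂; [_,_]′)
open import Data.Empty using (⊥; ⊥-elim)
open import Function using (Equivalence; _on_)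
open import Relation.Nullary using (¬_; Dec; yes; no; contradiction)
open import Relation.Nullary.Decidable using (⌊_⌋; toWitness; fromWitness; map′; _×-dec_; _→-dec_; ¬?)
open import Relation.Binary.Core using (Rel)
open import Relation.Binary.Definitions using (tri<; tri≈; tri>)
open import Relation.Binary.Structures using (IsDecEquivalence)
import Relation.Binary.Construct.On as On
open import Relation.Binary.PropositionalEquality using (_≡_; _≢_; refl; trans; cong; subst) renaming (sym to ≡-sym)

mutual
  ≈-refl : ∀ {a} → a ≈ a
  ≈-refl {c₀}        = c₀≈
  ≈-refl {pair a as} = pair≈ ≈-refl ≋-refl

  ≋-refl : ∀ {as} → as ≋ as
  ≋-refl {[]}     = []≋
  ≋-refl {x ∷ xs} = ∷≋ {ys = []} ≈-refl ≋-refl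

-- The mirror image of the constructor ∷≋: a matched element may be
-- inserted anywhere on the left.  This is what symmetry needs.
≋-insert : ∀ ys {y zs xs x} → (ys ++ zs) ≋ xs → y ≈ x → (ys ++ y ∷ zs) ≋ (x ∷ xs)
≋-insert []       p e = ∷≋ {ys = []} e p
≋-insert (a ∷ ys) {x = x} (∷≋ {ys = cs} a≈c p) e = ∷≋ {ys = x ∷ cs} a≈c (≋-insert ys p e)

mutual
  ≈-sym : ∀ {a b} → a ≈ b → b ≈ a
  ≈-sym c₀≈         = c₀≈
  ≈-sym (pair≈ e p) = pair≈ (≈-sym e) (≋-sym p)

  ≋-sym : ∀ {as bs} → as ≋ bs → bs ≋ as
  ≋-sym []≋                 = []≋
  ≋-sym (∷≋ {ys = ys} e p) = ≋-insert ys (≋-sym p) (≈-sym e)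

++-split : ∀ {A : Set} (cs ds ps qs : List A) (p : A) → cs ++ ds ≡ ps ++ p ∷ qs →
  (∃[ r ] cs ≡ ps ++ p ∷ r × qs ≡ r ++ ds) ⊎ (∃[ r ] ds ≡ r ++ p ∷ qs × ps ≡ cs ++ r)
++-split []       ds ps       qs p eq   = inj₂ (ps , eq , refl)
++-split (c ∷ cs) ds []       qs p refl = inj₁ (cs , refl , refl)
++-split (c ∷ cs) ds (x ∷ ps) qs p eq with ∷-injective eq
... | refl , eq′ with ++-split cs ds ps qs p eq′
...   | inj₁ (r , e₁ , e₂) = inj₁ (r , cong (c ∷_) e₁ , e₂)
...   | inj₂ (r , e₁ , e₂) = inj₂ (r , e₁ , cong (c ∷_) e₂)

≋-extract : ∀ ys {y zs M} → (ys ++ y ∷ zs) ≋ M →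
  ∃[ ps ] ∃[ p ] ∃[ qs ] M ≡ ps ++ p ∷ qs × y ≈ p × (ys ++ zs) ≋ (ps ++ qs)
≋-extract []       (∷≋ {ys = ps} {zs = qs} e q) = ps , _ , qs , refl , e , q
≋-extract (a ∷ ys) {zs = zs} (∷≋ {y = c} {ys = cs} {zs = ds} a≈c q)
  with ≋-extract ys q
... | ps , p , qs , eq , y≈p , r with ++-split cs ds ps qs p eq
...   | inj₁ (t , refl , refl) =
  ps , p , t ++ c ∷ ds , ++-assoc ps (p ∷ t) (c ∷ ds) , y≈p ,
  subst (λ Z → (a ∷ (ys ++ zs)) ≋ Z) (++-assoc ps t (c ∷ ds))
    (∷≋ {ys = ps ++ t} a≈c (subst ((ys ++ zs) ≋_) (≡-sym (++-assoc ps t ds)) r))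
...   | inj₂ (t , refl , refl) =
  cs ++ c ∷ t , p , qs , ≡-sym (++-assoc cs (c ∷ t) (p ∷ qs)) , y≈p ,
  subst (λ Z → (a ∷ (ys ++ zs)) ≋ Z) (≡-sym (++-assoc cs (c ∷ t) qs))
    (∷≋ {ys = cs} a≈c (subst ((ys ++ zs) ≋_) (++-assoc cs t qs) r))

mutual
  ≈-trans : ∀ {a b c} → a ≈ b → b ≈ c → a ≈ c
  ≈-trans c₀≈         c₀≈           = c₀≈
  ≈-trans (pair≈ e p) (pair≈ e′ p′) = pair≈ (≈-trans e e′) (≋-trans p p′)

  ≋-trans : ∀ {as bs cs} → as ≋ bs → bs ≋ cs → as ≋ cs
  ≋-trans []≋                 []≋ = []≋
  ≋-trans (∷≋ {ys = ys} e p) q with ≋-extract ys q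
  ... | _ , _ , _ , refl , e′ , r = ∷≋ (≈-trans e e′) (≋-trans p r)

-- All ways of writing a list as ys ++ y ∷ zs; deciding x ∷ xs ≋ L
-- amounts to searching this finite list for a place to match x.
splits : List Colour → List (List Colour × Colour × List Colour)
splits []      = []
splits (y ∷ L) = ([] , y , L) ∷ map (map₁ (y ∷_)) (splits L)

splits-sound : ∀ L {ys y zs} → (ys , y , zs) ∈ splits L → L ≡ ys ++ y ∷ zs
splits-sound (y ∷ L) (here refl) = refl
splits-sound (y ∷ L) (there m) with ∈-map⁻ (map₁ (y ∷_)) m
... | _ , m′ , refl = cong (y ∷_) (splits-sound L m′)

splits-complete : ∀ ys y zs → (ys , y , zs) ∈ splits (ys ++ y ∷ zs)
splits-complete []       y zs = here refl
splits-complete (a ∷ ys) y zs = there (∈-map⁺ (map₁ (a ∷_)) (splits-complete ys y zs))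

MatchAt : Colour → List Colour → List Colour × Colour × List Colour → Set
MatchAt x xs (ys , y , zs) = x ≈ y × xs ≋ (ys ++ zs)

mutual
  _≈?_ : (a b : Colour) → Dec (a ≈ b)
  c₀        ≈? c₀        = yes c₀≈
  c₀        ≈? pair _ _  = no λ ()
  pair _ _  ≈? c₀        = no λ ()
  pair a as ≈? pair b bs =
    map′ (uncurry pair≈) (λ { (pair≈ e p) → e , p }) (a ≈? b ×-dec as ≋? bs)

  _≋?_ : (as bs : List Colour) → Dec (as ≋ bs)
  []       ≋? []      = yes []≋
  []       ≋? (_ ∷ _) = no λ ()
  (x ∷ xs) ≋? L       = map′ matched unmatched (Any.any? (matchAt? x xs) (splits L))
    where
      matched : Any (MatchAt x xs) (splits L) → (x ∷ xs) ≋ L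
      matched m with find m
      ... | (ys , y , zs) , m′ , e , p with splits-sound L m′
      ...   | refl = ∷≋ e p
      unmatched : (x ∷ xs) ≋ L → Any (MatchAt x xs) (splits L)
      unmatched (∷≋ {y = y} {ys = ys} {zs = zs} e p) = lose (splits-complete ys y zs) (e , p)

  matchAt? : ∀ x xs t → Dec (MatchAt x xs t)
  matchAt? x xs (ys , y , zs) = x ≈? y ×-dec xs ≋? (ys ++ zs)

≈-isDecEquivalence : IsDecEquivalence _≈_
≈-isDecEquivalence = record
  { isEquivalence = record { refl = ≈-refl ; sym = ≈-sym ; trans = ≈-trans }
  ; _≟_ = _≈?_
  }

≋-length : ∀ {xs ys} → xs ≋ ys → length xs ≡ length ys
≋-length []≋                           = refl
≋-length (∷≋ {ys = ys} {zs = zs} _ p) = trans (cong suc (≋-length p)) (≡-sym (length-++-sucʳ ys _ zs))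

≋-∈ : ∀ {xs ys a} → a ∈ xs → xs ≋ ys → ∃[ c ] c ∈ ys × a ≈ c
≋-∈ (here refl) (∷≋ {ys = ys} e _) = _ , ∈-++⁺ʳ ys (here refl) , e
≋-∈ (there m)   (∷≋ {ys = ys} _ p) with ≋-∈ m p
... | c , c∈ , a≈c with ∈-++⁻ ys c∈
...   | inj₁ c∈ys = c , ∈-++⁺ˡ c∈ys , a≈c
...   | inj₂ c∈zs = c , ∈-++⁺ʳ ys (there c∈zs) , a≈c

record Matching {A B : Set} (Q : A → B → Set) (xs : List A) (ys : List B) : Set where
  field
    partner        : ∀ {x} → x ∈ xs → ∃[ y ] y ∈ ys × Q x y
    partner-unique : ∀ {x x′ y} → x ∈ xs → x′ ∈ xs → Q x y → Q x′ y → x ≡ x′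

∈-remove : ∀ {A : Set} (ys₁ ys₂ : List A) {y z : A} → z ∈ ys₁ ++ y ∷ ys₂ → z ≡ y ⊎ z ∈ ys₁ ++ ys₂
∈-remove ys₁ ys₂ m with ∈-++⁻ ys₁ m
... | inj₁ m₁         = inj₂ (∈-++⁺ˡ m₁)
... | inj₂ (here e)   = inj₁ e
... | inj₂ (there m₂) = inj₂ (∈-++⁺ʳ ys₁ m₂)

matching-tail : ∀ {A B : Set} {Q : A → B → Set} {x xs} ys₁ {y} ys₂ → Unique (x ∷ xs) →
  Matching Q (x ∷ xs) (ys₁ ++ y ∷ ys₂) → Q x y → Matching Q xs (ys₁ ++ ys₂)
matching-tail {Q = Q} {x} {xs} ys₁ {y} ys₂ (x∉xs ∷ _) M qxy = record
  { partner        = partner′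
  ; partner-unique = λ m m′ → partner-unique (there m) (there m′)
  }
  where
    open Matching M
    partner′ : ∀ {x′} → x′ ∈ xs → ∃[ y′ ] y′ ∈ ys₁ ++ ys₂ × Q x′ y′
    partner′ m with partner (there m)
    ... | y′ , y′∈ , q with ∈-remove ys₁ ys₂ y′∈
    ...   | inj₂ y′∈′ = y′ , y′∈′ , q
    ...   | inj₁ refl = ⊥-elim (All.lookup x∉xs m (partner-unique (here refl) (there m) qxy q))

matching-length : ∀ {A B : Set} {Q : A → B → Set} {xs ys} → Unique xs → Matching Q xs ys →
  length xs ≤ length ys
matching-length {xs = []}     _ _ = z≤n
matching-length {xs = x ∷ xs} u@(_ ∷ u′) M with Matching.partner M (here refl)
... | y , y∈ , q with ∈-∃++ y∈
...   | ys₁ , ys₂ , refl =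
  subst (suc (length xs) ≤_) (≡-sym (length-++-sucʳ ys₁ y ys₂))
    (s≤s (matching-length u′ (matching-tail ys₁ ys₂ u M q)))

⊆-length : ∀ {A : Set} {xs ys : List A} → Unique xs → (∀ {x} → x ∈ xs → x ∈ ys) →
  length xs ≤ length ys
⊆-length u sub = matching-length {Q = _≡_} u record
  { partner        = λ m → _ , sub m , refl
  ; partner-unique = λ { _ _ refl refl → refl } }

matching-≋ : ∀ {A : Set} (f : A → Colour) {xs ys} → Unique xs → length xs ≡ length ys →
  Matching (λ x y → f x ≈ f y) xs ys → map f xs ≋ map f ys
matching-≋ f {[]}     {[]}    _ _  _ = []≋
matching-≋ f {[]}     {_ ∷ _} _ () _
matching-≋ f {x ∷ xs} u@(_ ∷ u′) len M with Matching.partner M (here refl)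
... | y , y∈ , q with ∈-∃++ y∈
...   | ys₁ , ys₂ , refl =
  subst ((f x ∷ map f xs) ≋_) (≡-sym (map-++ f ys₁ (y ∷ ys₂)))
    (∷≋ {ys = map f ys₁} q
      (subst (map f xs ≋_) (map-++ f ys₁ ys₂)
        (matching-≋ f u′ (suc-injective (trans len (length-++-sucʳ ys₁ y ys₂)))
          (matching-tail ys₁ ys₂ u M q))))

map-split : ∀ {A : Set} (f : A → Colour) ps {p qs} bs → map f bs ≡ ps ++ p ∷ qs →
  ∃[ bs₁ ] ∃[ b ] ∃[ bs₂ ]
    bs ≡ bs₁ ++ b ∷ bs₂ × map f bs₁ ≡ ps × f b ≡ p × map f bs₂ ≡ qs
map-split f []       (b ∷ bs) eq with ∷-injective eq
... | e₁ , e₂ = [] , b , bs , refl , refl , e₁ , e₂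
map-split f (a ∷ ps) (b ∷ bs) eq with ∷-injective eq
... | refl , eq′ with map-split f ps bs eq′
...   | bs₁ , b′ , bs₂ , refl , e₁ , e₂ , e₃ = b ∷ bs₁ , b′ , bs₂ , refl , cong (f b ∷_) e₁ , e₂ , e₃

≋-transfer : ∀ {A : Set} {X : A → Set} (f g : A → Colour) →
  (∀ {a b} → X a → X b → f a ≈ f b → g a ≈ g b) →
  ∀ {as bs} → All X as → All X bs → map f as ≋ map f bs → map g as ≋ map g bs
≋-transfer f g fg {[]}     {[]}    _ _ _  = []≋
≋-transfer f g fg {[]}     {_ ∷ _} _ _ ()
≋-transfer f g fg {a ∷ as} {bs} (xa ∷ xas) xbs p with ≋-extract [] p
... | ps , _ , qs , eq , e , r with map-split f ps bs eq
...   | bs₁ , b , bs₂ , refl , refl , refl , refl with All.++⁻ bs₁ xbs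
...     | xbs₁ , xb ∷ xbs₂ =
  subst ((g a ∷ map g as) ≋_) (≡-sym (map-++ g bs₁ (b ∷ bs₂)))
    (∷≋ {ys = map g bs₁} (fg xa xb e)
      (subst (map g as ≋_) (map-++ g bs₁ bs₂)
        (≋-transfer f g fg xas (All.++⁺ xbs₁ xbs₂)
          (subst (map f as ≋_) (≡-sym (map-++ f bs₁ bs₂)) r))))

module Subset {n : ℕ} (P : Fin n → Bool) where

  Member : Fin n → Set
  Member v = T (P v)

  elems : List (Fin n)
  elems = filterᵇ P (allFin n)

  size : ℕ
  size = length elems

  ∈-elems : ∀ {v} → Member v → v ∈ elems
  ∈-elems {v} = ∈-filter⁺ (λ x → T? (P x)) (∈-allFin v)

  elems-member : ∀ {v} → v ∈ elems → Member v
  elems-member m = proj₂ (∈-filter⁻ (λ x → T? (P x)) {xs = allFin n} m)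

  elems-unique : Unique elems
  elems-unique = filter⁺ (λ x → T? (P x)) (allFin⁺ n)

  elems-members : All Member elems
  elems-members = All.tabulate elems-member

  nonempty : ∀ {v} → Member v → 1 ≤ size
  nonempty pv = ⊆-length ([] ∷ []) λ { (here refl) → ∈-elems pv }

  size≤n : size ≤ n
  size≤n = ≤-trans (length-filter (λ x → T? (P x)) (allFin n)) (≤-reflexive (length-tabulate (λ x → x)))

  -- The classes of a decidable equivalence _∼_ restricted to the subset.
  -- Each class is represented by its element of least index; the number of
  -- classes is the number of representatives.
  module Classes {_∼_ : Rel (Fin n) 0ℓ} (∼-isDecEquivalence : IsDecEquivalence _∼_) where

    open IsDecEquivalence ∼-isDecEquivalence
      renaming (refl to ∼-refl; sym to ∼-sym; trans to ∼-trans; _≟_ to _∼?_)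

    Earlier : Fin n → Fin n → Set
    Earlier v w = toℕ w < toℕ v × Member w × w ∼ v

    earlier? : ∀ v w → Dec (Earlier v w)
    earlier? v w = toℕ w <ℕ? toℕ v ×-dec T? (P w) ×-dec w ∼? v

    Rep : Fin n → Set
    Rep v = Member v × ¬ ∃ (Earlier v)

    rep? : ∀ v → Dec (Rep v)
    rep? v = T? (P v) ×-dec ¬? (any? (earlier? v))

    reps : List (Fin n)
    reps = filter rep? (allFin n)

    count : ℕ
    count = length reps

    reps-unique : Unique reps
    reps-unique = filter⁺ rep? (allFin⁺ n)

    ∈-reps : ∀ {v} → Rep v → v ∈ reps
    ∈-reps {v} = ∈-filter⁺ rep? (∈-allFin v)

    reps-rep : ∀ {v} → v ∈ reps → Rep v
    reps-rep m = proj₂ (∈-filter⁻ rep? {xs = allFin n} m)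

    rep-exists : ∀ {v} → Member v → ∃[ r ] Rep r × r ∼ v
    rep-exists {v} = go v (<-wellFounded (toℕ v))
      where
        go : ∀ v → Acc _<_ (toℕ v) → Member v → ∃[ r ] Rep r × r ∼ v
        go v (acc rs) pv with any? (earlier? v)
        ... | no none = v , (pv , none) , ∼-refl
        ... | yes (w , w<v , pw , w∼v) with go w (rs w<v) pw
        ...   | r , rep , r∼w = r , rep , ∼-trans r∼w w∼v

    rep-unique : ∀ {r r′} → Rep r → Rep r′ → r ∼ r′ → r ≡ r′
    rep-unique {r} {r′} (pr , none) (pr′ , none′) r∼r′ with <-cmp (toℕ r) (toℕ r′)
    ... | tri< r<r′ _ _ = ⊥-elim (none′ (r , r<r′ , pr , r∼r′))
    ... | tri≈ _ eq _   = toℕ-injective eq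
    ... | tri> _ _ r′<r = ⊥-elim (none (r′ , r′<r , pr′ , ∼-sym r∼r′))

    Antichain : List (Fin n) → Set
    Antichain = AllPairs (λ a b → ¬ a ∼ b)

    antichain-collapse : ∀ {xs} → Antichain xs → ∀ {a b} → a ∈ xs → b ∈ xs → a ∼ b → a ≡ b
    antichain-collapse (_ ∷ _)     (here refl) (here refl) _   = refl
    antichain-collapse (apart ∷ _) (here refl) (there b∈)  a∼b = ⊥-elim (All.lookup apart b∈ a∼b)
    antichain-collapse (apart ∷ _) (there a∈)  (here refl) a∼b = ⊥-elim (All.lookup apart a∈ (∼-sym a∼b))
    antichain-collapse (_ ∷ ac)    (there a∈)  (there b∈)  a∼b = antichain-collapse ac a∈ b∈ a∼b

    unique-antichain : ∀ {Q : Fin n → Set} → (∀ {a b} → Q a → Q b → a ∼ b → a ≡ b) →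
      ∀ {xs} → All Q xs → Unique xs → Antichain xs
    unique-antichain collapse []         []           = []
    unique-antichain collapse (qa ∷ qas) (a∉as ∷ u) =
      All.zipWith (λ { (a≢b , qb) a∼b → a≢b (collapse qa qb a∼b) }) (a∉as , qas)
        ∷ unique-antichain collapse qas u

    reps-antichain : Antichain reps
    reps-antichain = unique-antichain rep-unique (All.tabulate reps-rep) reps-unique

    -- An antichain of members has at most count elements: distinct entries
    -- lie in the classes of distinct representatives.
    antichain≤count : ∀ {xs} → All Member xs → Antichain xs → length xs ≤ count
    antichain≤count {xs} pxs ac =
      matching-length (AllPairs.map (λ { a≁b refl → a≁b ∼-refl }) ac) record
        { partner        = partner
        ; partner-unique = λ m m′ r∼x r∼x′ → antichain-collapse ac m m′ (∼-trans (∼-sym r∼x) r∼x′)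
        }
      where
        partner : ∀ {x} → x ∈ xs → ∃[ r ] r ∈ reps × r ∼ x
        partner m with rep-exists (All.lookup pxs m)
        ... | r , rep , r∼x = r , ∈-reps rep , r∼x

    count-pos : ∀ {v} → Member v → 1 ≤ count
    count-pos pv = antichain≤count (pv ∷ []) ([] ∷ [])

    count≤size : count ≤ size
    count≤size = ⊆-length reps-unique (λ m → ∈-elems (proj₁ (reps-rep m)))

    Discrete : Set
    Discrete = ∀ {v w} → Member v → Member w → v ∼ w → v ≡ w

    non-rep-bound : ∀ {z} → Member z → ¬ Rep z → suc count ≤ size
    non-rep-bound {z} pz nz = ⊆-length (z∉reps ∷ reps-unique) sub
      where
        z∉reps : All (z ≢_) reps
        z∉reps = All.tabulate λ { m refl → nz (reps-rep m) }
        sub : ∀ {x} → x ∈ z ∷ reps → x ∈ elems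
        sub (here refl) = ∈-elems pz
        sub (there m)   = ∈-elems (proj₁ (reps-rep m))

    discrete-if-full : size ≤ count → Discrete
    discrete-if-full full {v} {w} pv pw v∼w with rep? v | rep? w
    ... | yes rv | yes rw = rep-unique rv rw v∼w
    ... | no nv  | _      = contradiction (≤-trans (non-rep-bound pv nv) full) (<-irrefl refl)
    ... | yes _  | no nw  = contradiction (≤-trans (non-rep-bound pw nw) full) (<-irrefl refl)

  module Refinement {_∼_ _∼′_ : Rel (Fin n) 0ℓ}
    (D : IsDecEquivalence _∼_) (D′ : IsDecEquivalence _∼′_) (finer : ∀ {v w} → v ∼′ w → v ∼ w) where

    private
      module D  = IsDecEquivalence D
      module D′ = IsDecEquivalence D′
      module C  = Classes D
      module C′ = Classes D′

    -- If the class of a representative r contains a member z that is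
    -- split off from r, the representatives of _∼_ together with z form
    -- an antichain for _∼′_.
    split-class : ∀ {r z} → C.Rep r → Member z → r ∼ z → ¬ r ∼′ z → suc C.count ≤ C′.count
    split-class {r} {z} rep pz r∼z r≁′z =
      C′.antichain≤count (pz ∷ All.tabulate (λ m → proj₁ (C.reps-rep m)))
        (All.tabulate z-apart ∷ AllPairs.map (λ r≁r′ r∼′r′ → r≁r′ (finer r∼′r′)) C.reps-antichain)
      where
        z-apart : ∀ {r′} → r′ ∈ C.reps → ¬ z ∼′ r′
        z-apart m z∼′r′ with C.rep-unique rep (C.reps-rep m) (D.trans r∼z (finer z∼′r′))
        ... | refl = r≁′z (D′.sym z∼′r′)

    strict-refinement : ∀ {v w} → Member v → Member w → v ∼ w → ¬ v ∼′ w → suc C.count ≤ C′.count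
    strict-refinement {v} pv pw v∼w v≁′w with C.rep-exists pv
    ... | r , rep , r∼v with D′._≟_ r v
    ...   | yes r∼′v = split-class rep pw (D.trans r∼v v∼w) λ r∼′w → v≁′w (D′.trans (D′.sym r∼′v) r∼′w)
    ...   | no r≁′v  = split-class rep pv r∼v r≁′v

size-complement : ∀ {n} (P : Fin n → Bool) → Subset.size P + Subset.size (λ v → not (P v)) ≡ n
size-complement {n} P = trans (split (allFin n)) (length-tabulate (λ x → x))
  where
    split : ∀ xs → length (filterᵇ P xs) + length (filterᵇ (λ x → not (P x)) xs) ≡ length xs
    split []       = refl
    split (x ∷ xs) with P x
    ... | true  = cong suc (split xs)
    ... | false = trans (+-suc _ _) (cong suc (split xs))

size-strict-mono : ∀ {n} {P Q : Fin n → Bool} {z} → (∀ {v} → T (P v) → T (Q v)) →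
  T (Q z) → ¬ T (P z) → suc (Subset.size P) ≤ Subset.size Q
size-strict-mono {P = P} {Q} {z} P⊆Q qz npz = ⊆-length (z∉P ∷ Subset.elems-unique P) sub
  where
    z∉P : All (z ≢_) (Subset.elems P)
    z∉P = All.tabulate λ { m refl → npz (Subset.elems-member P m) }
    sub : ∀ {x} → x ∈ z ∷ Subset.elems P → x ∈ Subset.elems Q
    sub (here refl) = Subset.∈-elems Q qz
    sub (there m)   = Subset.∈-elems Q (P⊆Q (Subset.elems-member P m))

-- A set of vertices closed under adjacency, i.e. a union of connected components.
Closed : (G : Graph) → (Fin (n G) → Bool) → Set
Closed G X = ∀ {v u} → T (X v) → adj G v u ≡ true → T (X u)

record Split (G : Graph) : Set where
  field
    S L      : Fin (n G) → Bool
    S-closed : Closed G S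
    L-closed : Closed G L
    cover    : ∀ v → T (S v) ⊎ T (L v)
    disjoint : ∀ {v} → T (S v) → T (L v) → ⊥
    s₀ l₀    : Fin (n G)
    s₀∈S     : T (S s₀)
    l₀∈L     : T (L l₀)
    sizes    : Subset.size S + Subset.size L ≡ n G

swap : ∀ {G} → Split G → Split G
swap σ = record
  { S = L ; L = S ; S-closed = L-closed ; L-closed = S-closed
  ; cover = λ v → [ inj₂ , inj₁ ]′ (cover v) ; disjoint = λ l s → disjoint s l
  ; s₀ = l₀ ; l₀ = s₀ ; s₀∈S = l₀∈L ; l₀∈L = s₀∈S
  ; sizes = trans (+-comm (Subset.size L) (Subset.size S)) sizes }
  where open Split σ

module Component (G : Graph) (u₀ : Fin (n G)) where

  private
    V : Set
    V = Fin (n G)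

  reach : ℕ → V → Bool
  reach zero    v = ⌊ v ≟ u₀ ⌋
  reach (suc t) v = reach t v ∨ any (λ z → reach t z ∧ adj G z v) (allFin (n G))

  reach-u₀ : ∀ t → T (reach t u₀)
  reach-u₀ zero    = fromWitness refl
  reach-u₀ (suc t) = Equivalence.from T-∨ (inj₁ (reach-u₀ t))

  reach-mono : ∀ t {v} → T (reach t v) → T (reach (suc t) v)
  reach-mono t r = Equivalence.from T-∨ (inj₁ r)

  reach-step : ∀ t {z v} → T (reach t z) → adj G z v ≡ true → T (reach (suc t) v)
  reach-step t {z} r a = Equivalence.from T-∨ (inj₂ (any⁺ _ (lose (∈-allFin z)
    (Equivalence.from T-∧ (r , Equivalence.from T-≡ a)))))

  walk-snoc : ∀ {u z v} → Reachable G u z → adj G z v ≡ true → Reachable G u v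
  walk-snoc here         a = step a here
  walk-snoc (step a′ ρ) a = step a′ (walk-snoc ρ a)

  reach-sound : ∀ t {v} → T (reach t v) → Reachable G u₀ v
  reach-sound zero    r with toWitness r
  ... | refl = here
  reach-sound (suc t) r with Equivalence.to T-∨ r
  ... | inj₁ r′ = reach-sound t r′
  ... | inj₂ r′ with find (any⁻ _ (allFin (n G)) r′)
  ...   | z , _ , rz∧a with Equivalence.to T-∧ rz∧a
  ...     | rz , a = walk-snoc (reach-sound t rz) (Equivalence.to T-≡ a)

  saturates : ∀ t → (∃[ t′ ] Closed G (reach t′)) ⊎ suc t ≤ Subset.size (reach t)
  saturates zero = inj₂ (Subset.nonempty (reach 0) (reach-u₀ 0))
  saturates (suc t) with saturates t
  ... | inj₁ c = inj₁ c
  ... | inj₂ grown with any? (λ v → T? (reach (suc t) v) ×-dec ¬? (T? (reach t v)))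
  ...   | no none = inj₁ (t , closed)
    where
      closed : Closed G (reach t)
      closed {u = u} r a with T? (reach t u)
      ... | yes r′ = r′
      ... | no nr′ = ⊥-elim (none (_ , reach-step t r a , nr′))
  ...   | yes (z , rz , nz) = inj₂ (≤-trans (s≤s grown) (size-strict-mono {P = reach t} {Q = reach (suc t)} (reach-mono t) rz nz))

  component-closed : ∃[ t ] Closed G (reach t)
  component-closed with saturates (n G)
  ... | inj₁ c     = c
  ... | inj₂ grown = contradiction (≤-trans grown (Subset.size≤n (reach (n G)))) (<-irrefl refl)

disconnected-split : (G : Graph) → MoreThanOneComponent G → Split G
disconnected-split G (u₀ , v₀ , unreachable) = record
  { S = X ; L = λ v → not (X v)
  ; S-closed = X-closed ; L-closed = rest-closed
  ; cover = cover ; disjoint = disjoint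
  ; s₀ = u₀ ; l₀ = v₀ ; s₀∈S = reach-u₀ t ; l₀∈L = v₀∉X
  ; sizes = size-complement X }
  where
    open Component G u₀
    t : ℕ
    t = proj₁ component-closed
    X : Fin (n G) → Bool
    X = reach t
    X-closed : Closed G X
    X-closed = proj₂ component-closed

    cover : ∀ v → T (X v) ⊎ T (not (X v))
    cover v with X v
    ... | true  = inj₁ tt
    ... | false = inj₂ tt

    disjoint : ∀ {v} → T (X v) → T (not (X v)) → ⊥
    disjoint {v} x nx with X v
    ... | true = nx

    outside : ∀ {v} → ¬ T (X v) → T (not (X v))
    outside {v} nx with X v
    ... | true  = nx tt
    ... | false = tt

    rest-closed : Closed G (λ v → not (X v))
    rest-closed {v} {u} nxv a = outside λ xu → disjoint (X-closed xu (trans (Graph.sym G u v) a)) nxv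

    v₀∉X : T (not (X v₀))
    v₀∉X = outside λ x → unreachable (reach-sound t x)

¬→-witness : ∀ {A B : Set} → Dec A → ¬ (A → B) → A × ¬ B
¬→-witness (yes a) ¬a→b = a , λ b → ¬a→b (λ _ → b)
¬→-witness (no ¬a) ¬a→b = ⊥-elim (¬a→b (λ a → ⊥-elim (¬a a)))

module ColourRefinement (G : Graph) where

  V : Set
  V = Fin (n G)

  Same : ℕ → V → V → Set
  Same k = _≈_ on χ G k

  Same-isDecEquivalence : ∀ k → IsDecEquivalence (Same k)
  Same-isDecEquivalence k = On.isDecEquivalence (χ G k) ≈-isDecEquivalence

  Same-pred : ∀ {k v w} → Same (suc k) v w → Same k v w
  Same-pred (pair≈ e _) = e

  ≡⇒Same : ∀ {k v w} → v ≡ w → Same k v w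
  ≡⇒Same refl = ≈-refl

  ∈N⁺ : ∀ {v u} → adj G v u ≡ true → u ∈ N G v
  ∈N⁺ {v} {u} a = ∈-filter⁺ (λ x → T? (adj G v x)) (∈-allFin u) (Equivalence.from T-≡ a)

  ∈N⁻ : ∀ {v u} → u ∈ N G v → adj G v u ≡ true
  ∈N⁻ {v} m = Equivalence.to T-≡ (proj₂ (∈-filter⁻ (λ x → T? (adj G v x)) {xs = allFin (n G)} m))

  N-unique : ∀ v → Unique (N G v)
  N-unique v = filter⁺ (λ x → T? (adj G v x)) (allFin⁺ (n G))

  N-irreflexive : ∀ {v y} → y ∈ N G v → y ≢ v
  N-irreflexive {v} y∈ refl with trans (≡-sym (∈N⁻ y∈)) (irrfl G v)
  ... | ()

  Same-degree : ∀ {k v w} → Same (suc k) v w → length (N G v) ≡ length (N G w)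
  Same-degree {k} {v} {w} (pair≈ _ p) =
    trans (≡-sym (length-map (χ G k) (N G v))) (trans (≋-length p) (length-map (χ G k) (N G w)))

  StableAt : (V → Bool) → ℕ → V → V → Set
  StableAt X k v w = T (X v) → T (X w) → Same k v w → Same (suc k) v w

  Stable : (V → Bool) → ℕ → Set
  Stable X k = ∀ v w → StableAt X k v w

  stable-at? : ∀ X k v w → Dec (StableAt X k v w)
  stable-at? X k v w =
    T? (X v) →-dec T? (X w) →-dec (χ G k v ≈? χ G k w) →-dec (χ G (suc k) v ≈? χ G (suc k) w)

  stable? : ∀ X k → Dec (Stable X k)
  stable? X k = all? λ v → all? (stable-at? X k v)

  unstable-pair : ∀ X k → ¬ Stable X k →
    ∃[ v ] ∃[ w ] T (X v) × T (X w) × Same k v w × ¬ Same (suc k) v w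
  unstable-pair X k unstable
    with ¬∀⟶∃¬ (n G) (λ v → ∀ w → StableAt X k v w) (λ v → all? (stable-at? X k v)) unstable
  ... | v , ¬v with ¬∀⟶∃¬ (n G) (StableAt X k v) (stable-at? X k v) ¬v
  ... | w , ¬vw with ¬→-witness (T? (X v)) ¬vw
  ... | xv , ¬w with ¬→-witness (T? (X w)) ¬w
  ... | xw , ¬same with ¬→-witness (χ G k v ≈? χ G k w) ¬same
  ... | same , split = v , w , xv , xw , same , split

  neighbours-in : ∀ {X} → Closed G X → ∀ {v} → T (X v) → All (λ u → T (X u)) (N G v)
  neighbours-in closed xv = All.tabulate λ m → closed xv (∈N⁻ m)

  -- On a closed set X a stable round stays stable: the next colour of an
  -- X-vertex is computed from colours of neighbours, and these lie in X.
  stable-step : ∀ {X} → Closed G X → ∀ {k} → Stable X k → Stable X (suc k)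
  stable-step {X} closed {k} st v w xv xw s@(pair≈ _ p) =
    pair≈ s (≋-transfer (χ G k) (χ G (suc k)) (λ {a} {b} → st a b)
      (neighbours-in closed xv) (neighbours-in closed xw) p)

  stable-from : ∀ {X} → Closed G X → ∀ {k} → Stable X k → ∀ d → Stable X (d + k)
  stable-from closed st zero    = st
  stable-from closed st (suc d) = stable-step closed (stable-from closed st d)

  stable-forever : ∀ {X} → Closed G X → ∀ {k} → Stable X k →
    ∀ d {v w} → T (X v) → T (X w) → Same k v w → Same (d + k) v w
  stable-forever closed st zero    xv xw s = s
  stable-forever closed st (suc d) {v} {w} xv xw s =
    stable-from closed st d v w xv xw (stable-forever closed st d xv xw s)

module LongRefinementCounting (G : Graph) (j : ℕ)
  (splits-before : ∀ k → k < j → ¬ SamePartition G k (suc k)) (order : suc j ≡ n G) where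

  open ColourRefinement G public

  everything : V → Bool
  everything _ = true

  classes : ℕ → ℕ
  classes k = Subset.Classes.count everything (Same-isDecEquivalence k)

  round-splits : ∀ k → k < j → ∃[ v ] ∃[ w ] Same k v w × ¬ Same (suc k) v w
  round-splits k k<j with stable? everything k
  ... | yes st = contradiction (λ v w → st v w tt tt , Same-pred) (splits-before k k<j)
  ... | no unstable with unstable-pair everything k unstable
  ...   | v , w , _ , _ , same , split = v , w , same , split

  classes-step : ∀ k → k < j → suc (classes k) ≤ classes (suc k)
  classes-step k k<j with round-splits k k<j
  ... | v , w , same , split =
    Subset.Refinement.strict-refinement everything (Same-isDecEquivalence k)
      (Same-isDecEquivalence (suc k)) Same-pred tt tt same split

  -- Round 0 has a class, since G has the vertex 0 (|G| = j + 1), and each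
  -- round up to j adds one.
  classes-lower : ∀ k → k ≤ j → suc k ≤ classes k
  classes-lower zero    _   = Subset.Classes.count-pos everything (Same-isDecEquivalence 0)
                                {subst Fin order Fin.zero} tt
  classes-lower (suc k) k<j = ≤-trans (s≤s (classes-lower k (<⇒≤ k<j))) (classes-step k k<j)

  -- The last round has as many classes as there are vertices, so it is discrete.
  final-discrete : ∀ {v w} → Same j v w → v ≡ w
  final-discrete = Subset.Classes.discrete-if-full everything (Same-isDecEquivalence j)
    (≤-trans (Subset.size≤n everything) (subst (_≤ classes j) order (classes-lower j ≤-refl))) tt tt

  -- Conversely each round adds exactly one class: the d rounds from k to j
  -- add at least d classes, and there are at most j + 1 classes at the end.
  classes-upper : ∀ k → k ≤ j → classes k ≤ suc k
  classes-upper k k≤j = +-cancelˡ-≤ (j ∸ k) (classes k) (suc k) (begin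
    j ∸ k + classes k ≤⟨ gain (j ∸ k) k (m∸n+n≡m k≤j) ⟩
    classes j         ≤⟨ Subset.Classes.count≤size everything (Same-isDecEquivalence j) ⟩
    Subset.size everything ≤⟨ Subset.size≤n everything ⟩
    n G               ≡⟨ ≡-sym order ⟩
    suc j             ≡⟨ cong suc (≡-sym (m∸n+n≡m k≤j)) ⟩
    suc (j ∸ k + k)   ≡⟨ ≡-sym (+-suc (j ∸ k) k) ⟩
    j ∸ k + suc k     ∎)
    where
      open ≤-Reasoning
      gain : ∀ d k → d + k ≡ j → d + classes k ≤ classes j
      gain zero    k refl = ≤-refl
      gain (suc d) k eq   = begin
        suc d + classes k   ≡⟨ ≡-sym (+-suc d (classes k)) ⟩
        d + suc (classes k) ≤⟨ +-monoʳ-≤ d (classes-step k (subst (suc k ≤_) eq′ (m≤n+m (suc k) d))) ⟩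
        d + classes (suc k) ≤⟨ gain d (suc k) eq′ ⟩
        classes j           ∎
        where
          eq′ : d + suc k ≡ j
          eq′ = trans (+-suc d k) eq

  -- Inside a closed set X containing a vertex, colour refinement either has
  -- already separated all vertices of X, or it has produced at least one
  -- class more per round; so X is separated once the round exceeds |X| - 1.
  module OnClosed (X : V → Bool) (X-closed : Closed G X) {x₀ : V} (x₀∈X : T (X x₀)) where

    DiscreteOn : ℕ → Set
    DiscreteOn k = Subset.Classes.Discrete X (Same-isDecEquivalence k)

    classesOn : ℕ → ℕ
    classesOn k = Subset.Classes.count X (Same-isDecEquivalence k)

    discrete-or-growing : ∀ k → k ≤ j → DiscreteOn k ⊎ suc k ≤ classesOn k
    discrete-or-growing zero    _ = inj₂ (Subset.Classes.count-pos X (Same-isDecEquivalence 0) x₀∈X)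
    discrete-or-growing (suc k) k<j with discrete-or-growing k (<⇒≤ k<j)
    ... | inj₁ discrete = inj₁ λ xv xw s → discrete xv xw (Same-pred s)
    ... | inj₂ grown with stable? X k
    ...   | yes st = inj₁ λ {v} {w} xv xw s → final-discrete
            (subst (λ r → Same r v w) (m∸n+n≡m (<⇒≤ k<j))
              (stable-forever X-closed st (j ∸ k) xv xw (Same-pred s)))
    ...   | no unstable with unstable-pair X k unstable
    ...     | v , w , xv , xw , same , split = inj₂ (≤-trans (s≤s grown)
              (Subset.Refinement.strict-refinement X (Same-isDecEquivalence k)
                (Same-isDecEquivalence (suc k)) Same-pred xv xw same split))

    closed-discrete : ∀ k → k ≤ j → Subset.size X ≤ suc k → DiscreteOn k
    closed-discrete k k≤j small with discrete-or-growing k k≤j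
    ... | inj₁ discrete = discrete
    ... | inj₂ grown    = Subset.Classes.discrete-if-full X (Same-isDecEquivalence k) (≤-trans small grown)

module NoSplit (G : Graph) (j : ℕ) (splits-before : ∀ k → k < j → ¬ SamePartition G k (suc k))
  (order : suc j ≡ n G) (σ : Split G) (S≤L : Subset.size (Split.S σ) ≤ Subset.size (Split.L σ)) where

  open LongRefinementCounting G j splits-before order
  open Split σ
  module S-part = OnClosed S S-closed s₀∈S
  module L-part = OnClosed L L-closed l₀∈L

  m : ℕ
  m = Subset.size L ∸ 1

  1+m≡|L| : suc m ≡ Subset.size L
  1+m≡|L| = m+[n∸m]≡n (Subset.nonempty L l₀∈L)

  -- Since S is nonempty, |L| ≤ j, so round m is not yet the last one.
  m<j : m < j
  m<j = s≤s⁻¹ (begin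
    suc (suc m)                           ≡⟨ cong suc 1+m≡|L| ⟩
    1 + Subset.size L                     ≤⟨ +-monoˡ-≤ (Subset.size L) (Subset.nonempty S s₀∈S) ⟩
    Subset.size S + Subset.size L         ≡⟨ sizes ⟩
    n G                                   ≡⟨ ≡-sym order ⟩
    suc j                                 ∎)
    where open ≤-Reasoning

  -- Both parts are separated in round m, as |S| ≤ |L| = m + 1.
  S-discrete : S-part.DiscreteOn m
  S-discrete = S-part.closed-discrete m (<⇒≤ m<j) (≤-trans S≤L (≤-reflexive (≡-sym 1+m≡|L|)))

  L-discrete : L-part.DiscreteOn m
  L-discrete = L-part.closed-discrete m (<⇒≤ m<j) (≤-reflexive (≡-sym 1+m≡|L|))

  -- Round m + 1 still splits a colour class of round m, as m < j.  Both
  -- parts are separated in round m, so that class contains a vertex x of S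
  -- and a vertex ℓ of L.
  crossing-pair : ∃[ x ] ∃[ ℓ ] T (S x) × T (L ℓ) × Same m x ℓ × ¬ Same (suc m) x ℓ
  crossing-pair with round-splits m m<j
  ... | v , w , same , split with cover v | cover w
  ...   | inj₁ v∈S | inj₂ w∈L = v , w , v∈S , w∈L , same , split
  ...   | inj₂ v∈L | inj₁ w∈S = w , v , w∈S , v∈L , ≈-sym same , λ s → split (≈-sym s)
  ...   | inj₁ v∈S | inj₁ w∈S = ⊥-elim (split (≡⇒Same (S-discrete v∈S w∈S same)))
  ...   | inj₂ v∈L | inj₂ w∈L = ⊥-elim (split (≡⇒Same (L-discrete v∈L w∈L same)))

  module Crossing (x ℓ : V) (x∈S : T (S x)) (ℓ∈L : T (L ℓ))
    (same : Same m x ℓ) (split : ¬ Same (suc m) x ℓ) where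

    module Round = Subset.Classes everything (Same-isDecEquivalence (suc m))

    -- In round m+1 no vertex of L has the colour of x: by discreteness of L
    -- in round m such a vertex could only be ℓ.
    x-unmatched : ∀ {l} → T (L l) → ¬ Same (suc m) x l
    x-unmatched l∈L s with L-discrete l∈L ℓ∈L (≈-trans (≈-sym (Same-pred s)) same)
    ... | refl = split s

    -- Round m+1 has at most m+2 classes.  L occupies m+1 of them and x one
    -- more, so every other vertex of S shares its colour with a vertex of L.
    others-matched : ∀ {y} → T (S y) → y ≢ x → ∃[ l ] T (L l) × Same (suc m) y l
    others-matched {y} y∈S y≢x with any? (λ l → T? (L l) ×-dec (χ G (suc m) y ≈? χ G (suc m) l))
    ... | yes found = found
    ... | no none   = contradiction (≤-trans too-many (classes-upper (suc m) m<j)) (<-irrefl refl)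
      where
        L-antichain : Round.Antichain (Subset.elems L)
        L-antichain = Round.unique-antichain (λ a b s → L-discrete a b (Same-pred s))
          (Subset.elems-members L) (Subset.elems-unique L)
        antichain : Round.Antichain (y ∷ x ∷ Subset.elems L)
        antichain =
          ((λ s → y≢x (S-discrete y∈S x∈S (Same-pred s)))
             ∷ All.tabulate (λ l∈ s → none (_ , Subset.elems-member L l∈ , s)))
          ∷ All.tabulate (λ l∈ → x-unmatched (Subset.elems-member L l∈))
          ∷ L-antichain
        too-many : suc (suc (suc m)) ≤ classes (suc m)
        too-many = subst (λ k → suc (suc k) ≤ classes (suc m)) (≡-sym 1+m≡|L|)
          (Round.antichain≤count (All.tabulate (λ _ → tt)) antichain)

    -- Neighbours of x lie in S and are matched, colour-preservingly in round m,
    -- by neighbours of ℓ: a partner l of a neighbour y is adjacent to a vertex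
    -- of L with the colour of x, which can only be ℓ.
    neighbour-matching : Matching (Same m) (N G x) (N G ℓ)
    neighbour-matching = record
      { partner        = partner
      ; partner-unique = λ a∈ a′∈ a∼b a′∼b →
          S-discrete (S-closed x∈S (∈N⁻ a∈)) (S-closed x∈S (∈N⁻ a′∈)) (≈-trans a∼b (≈-sym a′∼b))
      }
      where
        partner : ∀ {y} → y ∈ N G x → ∃[ l ] l ∈ N G ℓ × Same m y l
        partner {y} y∈ with others-matched (S-closed x∈S (∈N⁻ y∈)) (N-irreflexive y∈)
        ... | l , l∈L , pair≈ y∼l ny≋nl
          with ≋-∈ (∈-map⁺ (χ G m) (∈N⁺ (trans (Graph.sym G y x) (∈N⁻ y∈)))) ny≋nl
        ...   | _ , c∈ , x∼c with ∈-map⁻ (χ G m) c∈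
        ...     | z , z∈ , refl with L-discrete (L-closed l∈L (∈N⁻ z∈)) ℓ∈L (≈-trans (≈-sym x∼c) same)
        ...       | refl = l , ∈N⁺ (trans (Graph.sym G ℓ l) (∈N⁻ z∈)) , y∼l

    -- x and ℓ have the same degree: for m ≥ 1 since they share a colour of
    -- round m, and for m = 0 since then L = {ℓ}, so ℓ is isolated.
    equal-degrees : length (N G x) ≡ length (N G ℓ)
    equal-degrees = by-round m refl same
      where
        by-round : ∀ k → k ≡ m → Same k x ℓ → length (N G x) ≡ length (N G ℓ)
        by-round (suc k) _   s = Same-degree s
        by-round zero    m≡0 _ = ≤-antisym (matching-length (N-unique x) neighbour-matching)
                                            (isolated (N G ℓ) no-neighbour)
          where
            no-neighbour : ∀ {z} → z ∈ N G ℓ → ⊥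
            no-neighbour z∈ = N-irreflexive z∈
              (subst L-part.DiscreteOn (≡-sym m≡0) L-discrete (L-closed ℓ∈L (∈N⁻ z∈)) ℓ∈L c₀≈)
            isolated : ∀ zs → (∀ {z} → z ∈ zs → ⊥) → length zs ≤ length (N G x)
            isolated []      _    = z≤n
            isolated (_ ∷ _) none = ⊥-elim (none (here refl))

    rejoined : Same (suc m) x ℓ
    rejoined = pair≈ same (matching-≋ (χ G m) (N-unique x) equal-degrees neighbour-matching)

  impossible : ⊥
  impossible with crossing-pair
  ... | x , ℓ , x∈S , ℓ∈L , same , split = split (Crossing.rejoined x ℓ x∈S ℓ∈L same split)

corollary12 : (G : Graph) → MoreThanOneComponent G → ¬ LongRefinement G
corollary12 G disconnected (j , (_ , splits-before) , order) = no-split (disconnected-split G disconnected)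
  where
    no-split : Split G → ⊥
    no-split σ with Subset.size (Split.S σ) ≤? Subset.size (Split.L σ)
    ... | yes S≤L = NoSplit.impossible G j splits-before order σ S≤L
    ... | no  S≰L = NoSplit.impossible G j splits-before order (swap σ) (<⇒≤ (≰⇒> S≰L))
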